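{- For every positive integer $k$ and every $\varepsilon>0$, the matrix $P_{2k}$ is $(\varepsilon,\frac{\varepsilon^4}{10^4k})$-good.
   Context: For a positive integer $m$, $P_m$ denotes the $2\times m$ zero-one matrix with $P_m(i,j)=1$ if $i+j$ is even and $P_m(i,j)=0$ otherwise. A zero-one matrix $P$ is $(\varepsilon,\delta)$-good if for all $n$, every $n\times n$ $P$-free zero-one matrix with at least $\varepsilon n^2$ 0-entries contains a $\delta n\times\delta n$ all-0 submatrix. A $k\times \ell$ matrix $P$ is contained in $A$ if there are rows $i_1<\dots<i_k$ and columns $j_1<\dots<j_\ell$ of $A$ with $A(i_a,j_b)=P(a,b)$ for all $a,b$; $A$ is $P$-free if it does not contain $P$. Floors and ceilings are omitted.
   Formalization: The parameter ε ranges over the positive rationals. -}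

module Defs where

open import Data.Nat using (ℕ; zero; suc; _+_; _%_; _≡ᵇ_)
open import Data.Fin using (Fin; toℕ; _<_)
open import Data.Bool using (Bool; true; false; if_then_else_)
open import Data.Product using (Σ; ∃; _×_; _,_)
open import Data.Integer using (+_)
open import Data.Rational using (ℚ; _/_; _≤_)
open import Relation.Binary.PropositionalEquality using (_≡_)

-- A zero-one matrix with r rows and c columns (true = 1, false = 0).
Matrix : ℕ → ℕ → Set
Matrix r c = Fin r → Fin c → Bool

StrictlyIncreasing : ∀ {a n} → (Fin a → Fin n) → Set
StrictlyIncreasing f = ∀ x y → x < y → f x < f y

-- P_m : 2 × m matrix, P_m(i,j) = 1 iff i + j is even (1-indexed;
-- with 0-indexed Fin the parity of i + j is the same).
P : (m : ℕ) → Matrix 2 m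
P m i j = (toℕ i + toℕ j) % 2 ≡ᵇ 0

Contains : ∀ {n k ℓ} → Matrix n n → Matrix k ℓ → Set
Contains {n} {k} {ℓ} A Q =
  Σ (Fin k → Fin n) λ r → Σ (Fin ℓ → Fin n) λ c →
    StrictlyIncreasing r × StrictlyIncreasing c ×
    (∀ a b → A (r a) (c b) ≡ Q a b)

Free : ∀ {n k ℓ} → Matrix n n → Matrix k ℓ → Set
Free A Q = Contains A Q → Data.Empty.⊥
  where import Data.Empty

sumFin : (n : ℕ) → (Fin n → ℕ) → ℕ
sumFin zero    f = 0
sumFin (suc n) f = f Fin.zero + sumFin n (λ i → f (Fin.suc i))
  where import Data.Fin as Fin

zeros : ∀ {n} → Matrix n n → ℕ
zeros {n} A = sumFin n (λ i → sumFin n (λ j → if A i j then 0 else 1))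

toℚ : ℕ → ℚ
toℚ n = + n / 1

HasZeroBlock : ∀ {n} → Matrix n n → ℚ → Set
HasZeroBlock {n} A δ =
  Σ ℕ λ a → Σ ℕ λ b → Σ (Fin a → Fin n) λ r → Σ (Fin b → Fin n) λ c →
    StrictlyIncreasing r × StrictlyIncreasing c ×
    (δ Data.Rational.* toℚ n ≤ toℚ a) × (δ Data.Rational.* toℚ n ≤ toℚ b) ×
    (∀ x y → A (r x) (c y) ≡ false)
  where import Data.Rational

Good : ∀ {k ℓ} → Matrix k ℓ → ℚ → ℚ → Set
Good Q ε δ = ∀ (n : ℕ) (A : Matrix n n) → Free A Q →
  ε Data.Rational.* toℚ (n Data.Nat.* n) ≤ toℚ (zeros A) → HasZeroBlock A δ
  where import Data.Rational
        import Data.Nat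

module Submission where

-- Write ε = p / q, let m = ⌊q / p⌋ + 1 (so at least n² / m entries are 0) and cut the columns into
-- t = 48km² blocks of width L = n / t. A row is rich in a block if at least L / 2m of its entries
-- there are 0; double counting gives at least n² / 4mL rich (row, block) pairs. Two rows cross in a
-- block if each has a 0 where the other has a 1. Crossing blocks of two rows i₁ < i₂ supply the
-- columns of a copy of P_{2k} (alternately one column from each direction of crossing), so any two
-- rows cross in fewer than 2k blocks. By Cauchy–Schwarz most pairs of rows rich in a common block
-- therefore do not cross there, i.e. one row follows the other: it is 0 wherever the other is 0.
-- Averaging yields a block J and a rich row r with at least kn / 2t followers; these rows and the
-- zeros of r in J span an all-0 submatrix with at least kn / 2t rows and n / 4mt columns, both at
-- least ε⁴n / 10⁴k. When n < 4mt a single 0 entry is already large enough.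

open import Defs

module FiniteSums where

  open import Data.Nat
  open import Data.Nat.Properties
  open import Data.Bool using (Bool; true; false; if_then_else_; _∨_)
  open import Data.Product using (Σ; ∃; _×_; _,_; map)
  open import Data.Sum using (inj₁; inj₂)
  open import Function using (_∘_; id)
  open import Relation.Nullary using (yes; no)
  open import Relation.Binary.PropositionalEquality
  open import Algebra.Properties.CommutativeSemigroup +-commutativeSemigroup using (interchange)
  open import Data.Nat.Tactic.RingSolver using (solve-∀)

  ∑ : ℕ → (ℕ → ℕ) → ℕ
  ∑ zero    f = 0
  ∑ (suc n) f = f 0 + ∑ n (f ∘ suc)

  syntax ∑ n (λ i → e) = ∑[ i < n ] e

  ∑-cong : ∀ n {f g : ℕ → ℕ} → (∀ i → i < n → f i ≡ g i) → ∑ n f ≡ ∑ n g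
  ∑-cong zero    eq = refl
  ∑-cong (suc n) eq = cong₂ _+_ (eq 0 z<s) (∑-cong n (λ i i<n → eq (suc i) (s<s i<n)))

  ∑-mono-≤ : ∀ n {f g : ℕ → ℕ} → (∀ i → i < n → f i ≤ g i) → ∑ n f ≤ ∑ n g
  ∑-mono-≤ zero    le = z≤n
  ∑-mono-≤ (suc n) le = +-mono-≤ (le 0 z<s) (∑-mono-≤ n (λ i i<n → le (suc i) (s<s i<n)))

  ∑-distrib-+ : ∀ n (f g : ℕ → ℕ) → ∑[ i < n ] (f i + g i) ≡ ∑ n f + ∑ n g
  ∑-distrib-+ zero    f g = refl
  ∑-distrib-+ (suc n) f g =
    trans (cong (f 0 + g 0 +_) (∑-distrib-+ n (f ∘ suc) (g ∘ suc))) (interchange (f 0) (g 0) _ _)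

  ∑-*ˡ : ∀ n c (f : ℕ → ℕ) → ∑[ i < n ] (c * f i) ≡ c * ∑ n f
  ∑-*ˡ zero    c f = sym (*-zeroʳ c)
  ∑-*ˡ (suc n) c f = trans (cong (c * f 0 +_) (∑-*ˡ n c (f ∘ suc))) (sym (*-distribˡ-+ c (f 0) _))

  ∑-const : ∀ n c → ∑[ _ < n ] c ≡ n * c
  ∑-const zero    c = refl
  ∑-const (suc n) c = cong (c +_) (∑-const n c)

  ∑-swap : ∀ n m (f : ℕ → ℕ → ℕ) → ∑[ i < n ] ∑[ j < m ] f i j ≡ ∑[ j < m ] ∑[ i < n ] f i j
  ∑-swap zero    m f = sym (trans (∑-const m 0) (*-zeroʳ m))
  ∑-swap (suc n) m f = trans (cong (∑[ j < m ] f 0 j +_) (∑-swap n m (f ∘ suc)))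
                             (sym (∑-distrib-+ m (f 0) (λ j → ∑[ i < n ] f (suc i) j)))

  ∑-++ : ∀ x y (f : ℕ → ℕ) → ∑ (x + y) f ≡ ∑ x f + ∑[ i < y ] f (x + i)
  ∑-++ zero    y f = refl
  ∑-++ (suc x) y f = trans (cong (f 0 +_) (∑-++ x y (f ∘ suc))) (sym (+-assoc (f 0) _ _))

  ∑-blocks : ∀ t L (f : ℕ → ℕ) → ∑ (t * L) f ≡ ∑[ J < t ] ∑[ s < L ] f (J * L + s)
  ∑-blocks zero    L f = refl
  ∑-blocks (suc t) L f = begin
    ∑ (L + t * L) f                                            ≡⟨ ∑-++ L (t * L) f ⟩
    ∑ L f + ∑[ i < t * L ] f (L + i)                           ≡⟨ cong (∑ L f +_) (∑-blocks t L (f ∘ (L +_))) ⟩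
    ∑ L f + ∑[ J < t ] ∑[ s < L ] f (L + (J * L + s))          ≡⟨ cong (∑ L f +_) (∑-cong t (λ J _ → ∑-cong L (λ s _ →
                                                                    cong f (sym (+-assoc L (J * L) s))))) ⟩
    ∑ L f + ∑[ J < t ] ∑[ s < L ] f (L + J * L + s)            ∎
    where open ≡-Reasoning

  ∑-≤-* : ∀ n c {f : ℕ → ℕ} → (∀ i → i < n → f i ≤ c) → ∑ n f ≤ n * c
  ∑-≤-* n c le = subst (_ ≤_) (∑-const n c) (∑-mono-≤ n le)

  ∑-product : ∀ n m (f g : ℕ → ℕ) → ∑[ i < n ] ∑[ j < m ] (f i * g j) ≡ ∑ n f * ∑ m g
  ∑-product n m f g = begin
    ∑[ i < n ] ∑[ j < m ] (f i * g j)  ≡⟨ ∑-cong n (λ i _ → ∑-*ˡ m (f i) g) ⟩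
    ∑[ i < n ] (f i * ∑ m g)           ≡⟨ ∑-cong n (λ i _ → *-comm (f i) (∑ m g)) ⟩
    ∑[ i < n ] (∑ m g * f i)           ≡⟨ ∑-*ˡ n (∑ m g) f ⟩
    ∑ m g * ∑ n f                      ≡⟨ *-comm (∑ m g) (∑ n f) ⟩
    ∑ n f * ∑ m g                      ∎
    where open ≡-Reasoning

  ∃-≥-of-∑-≥ : ∀ n e (f : ℕ → ℕ) → 0 < n → n * e ≤ ∑ n f → ∃ λ i → i < n × e ≤ f i
  ∃-≥-of-∑-≥ (suc n) e f _ le with e ≤? f 0
  ... | yes e≤f0 = 0 , z<s , e≤f0
  ... | no  e≰f0 with ∃-≥-of-∑-≥ n e (f ∘ suc) n>0 rest≥
    where
    n>0 : 0 < n
    n>0 = n≢0⇒n>0 (λ { refl → e≰f0 (subst₂ _≤_ (+-identityʳ e) (+-identityʳ (f 0)) le) })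
    rest≥ : n * e ≤ ∑ n (f ∘ suc)
    rest≥ = +-cancelˡ-≤ e _ _ (≤-trans le (+-monoˡ-≤ _ (<⇒≤ (≰⇒> e≰f0))))
  ...   | i , i<n , e≤fi = suc i , s<s i<n , e≤fi

  ∃-pos-of-∑-pos : ∀ n (f : ℕ → ℕ) → 0 < ∑ n f → ∃ λ i → i < n × 0 < f i
  ∃-pos-of-∑-pos (suc n) f pos with f 0 in eq
  ... | suc _ = 0 , z<s , subst (0 <_) (sym eq) z<s
  ... | zero with ∃-pos-of-∑-pos n (f ∘ suc) pos
  ...   | i , i<n , 0<fi = suc i , s<s i<n , 0<fi

  2ab≤a²+b²-shifted : ∀ a d → 2 * (a * (a + d)) ≤ a * a + (a + d) * (a + d)
  2ab≤a²+b²-shifted a d = subst (2 * (a * (a + d)) ≤_) (expand a d) (m≤m+n _ (d * d))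
    where
    expand : ∀ a d → 2 * (a * (a + d)) + d * d ≡ a * a + (a + d) * (a + d)
    expand = solve-∀

  2ab≤a²+b² : ∀ a b → 2 * (a * b) ≤ a * a + b * b
  2ab≤a²+b² a b with ≤-total a b
  ... | inj₁ a≤b = subst (λ b → 2 * (a * b) ≤ a * a + b * b) (m+[n∸m]≡n a≤b) (2ab≤a²+b²-shifted a (b ∸ a))
  ... | inj₂ b≤a = subst (λ a → 2 * (a * b) ≤ a * a + b * b) (m+[n∸m]≡n b≤a)
                     (subst₂ _≤_ (cong (2 *_) (*-comm b _)) (+-comm (b * b) _) (2ab≤a²+b²-shifted b (a ∸ b)))

  cauchy-schwarz : ∀ n (f : ℕ → ℕ) → ∑ n f * ∑ n f ≤ n * ∑[ i < n ] (f i * f i)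
  cauchy-schwarz n f = *-cancelˡ-≤ 2 (begin
    2 * (S * S)                                          ≡⟨ cong (2 *_) (sym (∑-product n n f f)) ⟩
    2 * ∑[ i < n ] ∑[ j < n ] (f i * f j)                ≡⟨ sym (∑-*ˡ n 2 _) ⟩
    ∑[ i < n ] (2 * ∑[ j < n ] (f i * f j))              ≡⟨ ∑-cong n (λ i _ → sym (∑-*ˡ n 2 _)) ⟩
    ∑[ i < n ] ∑[ j < n ] (2 * (f i * f j))              ≤⟨ ∑-mono-≤ n (λ i _ → ∑-mono-≤ n (λ j _ → 2ab≤a²+b² (f i) (f j))) ⟩
    ∑[ i < n ] ∑[ j < n ] (f i * f i + f j * f j)        ≡⟨ ∑-cong n (λ i _ → ∑-distrib-+ n _ _) ⟩
    ∑[ i < n ] (∑[ _ < n ] (f i * f i) + Q)              ≡⟨ ∑-distrib-+ n _ _ ⟩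
    ∑[ i < n ] ∑[ _ < n ] (f i * f i) + ∑[ _ < n ] Q     ≡⟨ cong₂ _+_ (∑-cong n (λ i _ → ∑-const n (f i * f i))) (∑-const n Q) ⟩
    ∑[ i < n ] (n * (f i * f i)) + n * Q                 ≡⟨ cong (_+ n * Q) (∑-*ˡ n n _) ⟩
    n * Q + n * Q                                        ≡⟨ cong (n * Q +_) (sym (+-identityʳ (n * Q))) ⟩
    2 * (n * Q)                                          ∎)
    where
    open ≤-Reasoning
    S Q : ℕ
    S = ∑ n f
    Q = ∑[ i < n ] (f i * f i)

  χ : Bool → ℕ
  χ b = if b then 1 else 0

  count : ℕ → (ℕ → Bool) → ℕ
  count n b = ∑[ i < n ] χ (b i)

  χ≤1 : ∀ b → χ b ≤ 1
  χ≤1 true  = ≤-refl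
  χ≤1 false = z≤n

  count≤ : ∀ n b → count n b ≤ n
  count≤ n b = subst (count n b ≤_) (*-identityʳ n) (∑-≤-* n 1 (λ i _ → χ≤1 (b i)))

  enumerate : ∀ n (b : ℕ → Bool) → Σ (ℕ → ℕ) λ e →
    (∀ x → x < count n b → e x < n × b (e x) ≡ true) × (∀ x y → x < y → e x < e y)
  enumerate zero    b = id , (λ _ ()) , (λ _ _ x<y → x<y)
  enumerate (suc n) b with enumerate n (b ∘ suc) | b 0 in b0
  ... | e , e-true , e-inc | false = suc ∘ e , (λ x x< → map s<s id (e-true x x<)) , (λ x y x<y → s<s (e-inc x y x<y))
  ... | e , e-true , e-inc | true  = e′ , e′-true , e′-inc
    where
    e′ : ℕ → ℕ
    e′ zero    = 0
    e′ (suc x) = suc (e x)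
    e′-true : ∀ x → x < suc (count n (b ∘ suc)) → e′ x < suc n × b (e′ x) ≡ true
    e′-true zero    _         = z<s , b0
    e′-true (suc x) (s<s x<) = map s<s id (e-true x x<)
    e′-inc : ∀ x y → x < y → e′ x < e′ y
    e′-inc zero    (suc y) _         = z<s
    e′-inc (suc x) (suc y) (s<s x<y) = s<s (e-inc x y x<y)

  anyBelow : ℕ → (ℕ → Bool) → Bool
  anyBelow zero    p = false
  anyBelow (suc L) p = p 0 ∨ anyBelow L (p ∘ suc)

  firstBelow : ℕ → (ℕ → Bool) → ℕ
  firstBelow zero    p = 0
  firstBelow (suc L) p = if p 0 then 0 else suc (firstBelow L (p ∘ suc))

  firstBelow-spec : ∀ L (p : ℕ → Bool) → anyBelow L p ≡ true → firstBelow L p < L × p (firstBelow L p) ≡ true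
  firstBelow-spec (suc L) p any with p 0 in p0
  ... | true  = z<s , p0
  ... | false = map s<s id (firstBelow-spec L (p ∘ suc) any)

  anyBelow-false : ∀ L (p : ℕ → Bool) → anyBelow L p ≡ false → ∀ s → s < L → p s ≡ false
  anyBelow-false (suc L) p none s s<L with p 0 in p0
  anyBelow-false (suc L) p none zero    _         | false = p0
  anyBelow-false (suc L) p none (suc s) (s<s s<L) | false = anyBelow-false L (p ∘ suc) none s s<L

  anyBelow-none : ∀ L (p : ℕ → Bool) → (∀ s → s < L → p s ≡ false) → anyBelow L p ≡ false
  anyBelow-none zero    p none = refl
  anyBelow-none (suc L) p none rewrite none 0 z<s = anyBelow-none L (p ∘ suc) (λ s s<L → none (suc s) (s<s s<L))

module Grids where

  open import Data.Nat
  open import Data.Nat.Properties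
  open import Data.Nat.DivMod using (m≡m%n+[m/n]*n; m%n<n; m/n*n≤m; m*n/n≡m; /-monoˡ-≤)
  open import Data.Bool using (Bool; true; false; not; _∧_; T)
  open import Data.Bool.Properties using (∧-comm)
  open import Data.Product using (_×_; _,_; proj₁; proj₂; map)
  open import Data.Empty using (⊥; ⊥-elim)
  open import Data.Unit using (tt)
  open import Function using (_∘_; id)
  open import Relation.Nullary using (yes; no)
  open import Relation.Binary using (tri<; tri≈; tri>)
  open import Relation.Binary.PropositionalEquality hiding (J)
  open import Data.Nat.Tactic.RingSolver using (solve-∀)
  open FiniteSums

  Grid : Set
  Grid = ℕ → ℕ → Bool

  Increasing : ℕ → ℕ → (ℕ → ℕ) → Set
  Increasing len n f = (∀ x → x < len → f x < n) × (∀ x y → x < y → y < len → f x < f y)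

  even : ℕ → Bool
  even x = x % 2 ≡ᵇ 0

  even-suc : ∀ x → even (suc x) ≡ not (even x)
  even-suc zero          = refl
  even-suc (suc zero)    = refl
  even-suc (suc (suc x)) = even-suc x

  P-Free : ℕ → ℕ → Grid → Set
  P-Free n k a = ∀ i₁ i₂ (c : ℕ → ℕ) → i₁ < i₂ → i₂ < n → Increasing (2 * k) n c →
    (∀ x → x < 2 * k → a i₁ (c x) ≡ even x × a i₂ (c x) ≡ even (suc x)) → ⊥

  zeroCount : ℕ → Grid → ℕ
  zeroCount n a = ∑[ i < n ] ∑[ j < n ] χ (not (a i j))

  record ZeroBlock (n : ℕ) (a : Grid) (d e : ℕ) : Set where
    field
      height width   : ℕ
      row col        : ℕ → ℕ
      row-increasing : Increasing height n row
      col-increasing : Increasing width n col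
      tall           : e ≤ d * height
      wide           : e ≤ d * width
      all-zero       : ∀ x y → x < height → y < width → a (row x) (col y) ≡ false

  singletonZeroBlock : ∀ n a d e → 0 < zeroCount n a → e ≤ d → ZeroBlock n a d e
  singletonZeroBlock n a d e pos e≤d with ∃-pos-of-∑-pos n (λ i → ∑[ j < n ] χ (not (a i j))) pos
  ... | i , i<n , pos-i with ∃-pos-of-∑-pos n (λ j → χ (not (a i j))) pos-i
  ...   | j , j<n , pos-ij = record
    { height = 1 ; width = 1 ; row = λ _ → i ; col = λ _ → j
    ; row-increasing = (λ _ _ → i<n) , single
    ; col-increasing = (λ _ _ → j<n) , single
    ; tall = e≤d*1 ; wide = e≤d*1
    ; all-zero = λ _ _ _ _ → χ-not-pos (a i j) pos-ij }
    where
    single : ∀ {v} x y → x < y → y < 1 → v < v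
    single x y x<y (s<s z≤n) = ⊥-elim (n≮0 x<y)
    e≤d*1 : e ≤ d * 1
    e≤d*1 = subst (e ≤_) (sym (*-identityʳ d)) e≤d
    χ-not-pos : ∀ b → 0 < χ (not b) → b ≡ false
    χ-not-pos false _ = refl

  blockColumn< : ∀ L J s → s < L → J * L + s < suc J * L
  blockColumn< L J s s<L = subst (J * L + s <_) (+-comm (J * L) L) (+-monoʳ-< (J * L) s<L)

  blockColumn-mono : ∀ L {J J′} s s′ → J < J′ → s < L → J * L + s < J′ * L + s′
  blockColumn-mono L {J} {J′} s s′ J<J′ s<L =
    <-≤-trans (blockColumn< L J s s<L) (≤-trans (*-monoˡ-≤ L J<J′) (m≤m+n (J′ * L) s′))

  blockColumn-bound : ∀ L t n J s → t * L ≤ n → J < t → s < L → J * L + s < n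
  blockColumn-bound L t n J s tL≤n J<t s<L =
    <-≤-trans (blockColumn< L J s s<L) (≤-trans (*-monoˡ-≤ L J<t) tL≤n)

  ∧≡true : ∀ {u v} → u ∧ v ≡ true → u ≡ true × v ≡ true
  ∧≡true {true} {true} _ = refl , refl

  not≡true : ∀ {u} → not u ≡ true → u ≡ false
  not≡true {false} _ = refl

  χ-∧-≤ : ∀ x y d e → χ (x ∧ y) ≤ χ (x ∧ not d) + χ (y ∧ not e) + χ (d ∧ e)
  χ-∧-≤ false y     d     e     = z≤n
  χ-∧-≤ true  false d     e     = z≤n
  χ-∧-≤ true  true  false e     = s≤s z≤n
  χ-∧-≤ true  true  true  false = s≤s z≤n
  χ-∧-≤ true  true  true  true  = s≤s z≤n

  χ-∧ : ∀ x y → χ (x ∧ y) ≡ χ x * χ y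
  χ-∧ false y     = refl
  χ-∧ true  true  = refl
  χ-∧ true  false = refl

  -- Blocks have width L = n / t; the last n % t columns belong to no block.
  module Blocks (a : Grid) (n m t : ℕ) .{{_ : NonZero t}} where

    L : ℕ
    L = n / t

    col : ℕ → ℕ → ℕ
    col J s = J * L + s

    tL≤n : t * L ≤ n
    tL≤n = subst (_≤ n) (*-comm L t) (m/n*n≤m n t)

    separatingAt : ℕ → ℕ → ℕ → ℕ → Bool
    separatingAt r r′ J s = not (a r (col J s)) ∧ a r′ (col J s)

    separates : ℕ → ℕ → ℕ → Bool
    separates r r′ J = anyBelow L (separatingAt r r′ J)

    crosses : ℕ → ℕ → ℕ → Bool
    crosses r r′ J = separates r r′ J ∧ separates r′ r J

    separatingColumn : ℕ → ℕ → ℕ → ℕ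
    separatingColumn r r′ J = firstBelow L (separatingAt r r′ J)

    separatingColumn-spec : ∀ r r′ J → separates r r′ J ≡ true →
      separatingColumn r r′ J < L × a r (col J (separatingColumn r r′ J)) ≡ false
                                  × a r′ (col J (separatingColumn r r′ J)) ≡ true
    separatingColumn-spec r r′ J sep with firstBelow-spec L (separatingAt r r′ J) sep
    ... | s<L , at = s<L , map not≡true id (∧≡true at)

    crossings<2k : ∀ {k} → P-Free n k a → ∀ r r′ → r < r′ → r′ < n → count t (crosses r r′) < 2 * k
    crossings<2k {k} free r r′ r<r′ r′<n with count t (crosses r r′) <? 2 * k
    ... | yes lt = lt
    ... | no ≮ with enumerate t (crosses r r′)
    ...   | J , J-crossing , J-increasing = ⊥-elim (free r r′ c r<r′ r′<n (c-bound , c-increasing) c-alternates)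
      where
      J-spec : ∀ x → x < 2 * k → J x < t × crosses r r′ (J x) ≡ true
      J-spec x x<2k = J-crossing x (<-≤-trans x<2k (≮⇒≥ ≮))
      offset : ℕ → ℕ
      offset x with even x
      ... | true  = separatingColumn r′ r (J x)
      ... | false = separatingColumn r r′ (J x)
      offset-spec : ∀ x → x < 2 * k →
        offset x < L × a r (col (J x) (offset x)) ≡ even x × a r′ (col (J x) (offset x)) ≡ even (suc x)
      offset-spec x x<2k rewrite even-suc x with even x | proj₂ (J-spec x x<2k)
      ... | true  | cr = let s<L , r′0 , r1 = separatingColumn-spec r′ r (J x) (proj₂ (∧≡true cr)) in s<L , r1 , r′0
      ... | false | cr = separatingColumn-spec r r′ (J x) (proj₁ (∧≡true cr))
      c : ℕ → ℕ
      c x = col (J x) (offset x)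
      c-bound : ∀ x → x < 2 * k → c x < n
      c-bound x x<2k = blockColumn-bound L t n (J x) (offset x) tL≤n (proj₁ (J-spec x x<2k)) (proj₁ (offset-spec x x<2k))
      c-increasing : ∀ x y → x < y → y < 2 * k → c x < c y
      c-increasing x y x<y y<2k =
        blockColumn-mono L (offset x) (offset y) (J-increasing x y x<y) (proj₁ (offset-spec x (<-trans x<y y<2k)))
      c-alternates : ∀ x → x < 2 * k → a r (c x) ≡ even x × a r′ (c x) ≡ even (suc x)
      c-alternates x x<2k = proj₂ (offset-spec x x<2k)

    separates-self : ∀ r J → separates r r J ≡ false
    separates-self r J = anyBelow-none L (separatingAt r r J) (λ s _ → not-∧-self (a r (col J s)))
      where
      not-∧-self : ∀ u → not u ∧ u ≡ false
      not-∧-self true  = refl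
      not-∧-self false = refl

    crossings≤2k : ∀ {k} → P-Free n k a → ∀ r r′ → r < n → r′ < n → count t (crosses r r′) ≤ 2 * k
    crossings≤2k {k} free r r′ r<n r′<n with <-cmp r r′
    ... | tri< r<r′ _ _ = <⇒≤ (crossings<2k {k} free r r′ r<r′ r′<n)
    ... | tri≈ _ refl _ = subst (_≤ _) (sym none) z≤n
      where
      none : count t (crosses r r) ≡ 0
      none = trans (∑-cong t (λ J _ → cong (λ b → χ (b ∧ b)) (separates-self r J))) (trans (∑-const t 0) (*-zeroʳ t))
    ... | tri> _ _ r′<r = subst (_≤ _) (∑-cong t (λ J _ → cong χ (∧-comm (separates r′ r J) _)))
                            (<⇒≤ (crossings<2k {k} free r′ r r′<r r<n))

    ∑³ : (ℕ → ℕ → ℕ → ℕ) → ℕ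
    ∑³ f = ∑[ J < t ] ∑[ r < n ] ∑[ r′ < n ] f J r r′

    ∑³-distrib-+ : ∀ f g → ∑³ (λ J r r′ → f J r r′ + g J r r′) ≡ ∑³ f + ∑³ g
    ∑³-distrib-+ f g = trans (∑-cong t (λ J _ → trans (∑-cong n (λ r _ → ∑-distrib-+ n _ _)) (∑-distrib-+ n _ _)))
                             (∑-distrib-+ t _ _)

    ∑³-mono-≤ : ∀ f g → (∀ J r r′ → f J r r′ ≤ g J r r′) → ∑³ f ≤ ∑³ g
    ∑³-mono-≤ f g le = ∑-mono-≤ t (λ J _ → ∑-mono-≤ n (λ r _ → ∑-mono-≤ n (λ r′ _ → le J r r′)))

    ∑³-flip : ∀ f → ∑³ (λ J r r′ → f J r′ r) ≡ ∑³ f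
    ∑³-flip f = ∑-cong t (λ J _ → ∑-swap n n (λ r r′ → f J r′ r))

    crossingCount : ℕ
    crossingCount = ∑³ λ J r r′ → χ (crosses r r′ J)

    crossingCount≤ : ∀ {k} → P-Free n k a → crossingCount ≤ n * (n * (2 * k))
    crossingCount≤ {k} free = begin
      crossingCount                                          ≡⟨ ∑-swap t n _ ⟩
      ∑[ r < n ] ∑[ J < t ] ∑[ r′ < n ] χ (crosses r r′ J)   ≡⟨ ∑-cong n (λ r _ → ∑-swap t n _) ⟩
      ∑[ r < n ] ∑[ r′ < n ] count t (crosses r r′)          ≤⟨ ∑-≤-* n _ (λ r r<n → ∑-≤-* n _ (λ r′ r′<n →
                                                                  crossings≤2k {k} free r r′ r<n r′<n)) ⟩
      n * (n * (2 * k))                                      ∎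
      where open ≤-Reasoning

    zerosIn : ℕ → ℕ → ℕ
    zerosIn r J = count L (λ s → not (a r (col J s)))

    rich : ℕ → ℕ → Bool
    rich r J = L ≤ᵇ 2 * m * zerosIn r J

    richRows : ℕ → ℕ
    richRows J = count n (λ r → rich r J)

    richPairs : ℕ
    richPairs = ∑ t richRows

    follows : ℕ → ℕ → ℕ → Bool
    follows r r′ J = not (separates r r′ J)

    followers : ℕ → ℕ → ℕ
    followers J r = count n (λ r′ → rich r J ∧ follows r r′ J)

    followerCount : ℕ
    followerCount = ∑[ J < t ] ∑[ r < n ] followers J r

    follower-zero : ∀ {r r′ J s} → follows r r′ J ≡ true → s < L → a r (col J s) ≡ false → a r′ (col J s) ≡ false
    follower-zero {r} {r′} {J} {s} follows-r s<L r0 =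
      zero-of-follower (a r (col J s)) (a r′ (col J s)) r0
        (anyBelow-false L (separatingAt r r′ J) (not≡true follows-r) s s<L)
      where
      zero-of-follower : ∀ u v → u ≡ false → not u ∧ v ≡ false → v ≡ false
      zero-of-follower false v _ v≡false = v≡false

    -- Two rows rich in the same block either cross there or one of them follows the other.
    ∑richRows²≤ : ∑[ J < t ] (richRows J * richRows J) ≤ followerCount + followerCount + crossingCount
    ∑richRows²≤ = begin
      ∑[ J < t ] (richRows J * richRows J)
        ≡⟨ ∑-cong t (λ J _ → sym (trans (∑-cong n (λ r _ → ∑-cong n (λ r′ _ → χ-∧ (rich r J) (rich r′ J))))
                                         (∑-product n n _ _))) ⟩
      ∑³ (λ J r r′ → χ (rich r J ∧ rich r′ J))
        ≤⟨ ∑³-mono-≤ _ _ (λ J r r′ → χ-∧-≤ (rich r J) (rich r′ J) (separates r r′ J) (separates r′ r J)) ⟩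
      ∑³ (λ J r r′ → χ (rich r J ∧ follows r r′ J) + χ (rich r′ J ∧ follows r′ r J) + χ (crosses r r′ J))
        ≡⟨ trans (∑³-distrib-+ _ _) (cong (_+ crossingCount) (∑³-distrib-+ _ _)) ⟩
      followerCount + ∑³ (λ J r r′ → χ (rich r′ J ∧ follows r′ r J)) + crossingCount
        ≡⟨ cong (λ x → followerCount + x + crossingCount) (∑³-flip (λ J r r′ → χ (rich r J ∧ follows r r′ J))) ⟩
      followerCount + followerCount + crossingCount ∎
      where open ≤-Reasoning

    n≡tL+n%t : n ≡ t * L + n % t
    n≡tL+n%t = trans (m≡m%n+[m/n]*n n t) (trans (+-comm (n % t) _) (cong (_+ n % t) (*-comm L t)))

    blockZeros : ℕ
    blockZeros = ∑[ i < n ] ∑[ J < t ] zerosIn i J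

    rowZeros≤ : ∀ i → ∑[ j < n ] χ (not (a i j)) ≤ ∑[ J < t ] zerosIn i J + t
    rowZeros≤ i = begin
      ∑ n z                                              ≡⟨ cong (λ N → ∑ N z) n≡tL+n%t ⟩
      ∑ (t * L + n % t) z                                ≡⟨ ∑-++ (t * L) (n % t) z ⟩
      ∑ (t * L) z + ∑[ j < n % t ] z (t * L + j)         ≡⟨ cong (_+ ∑[ j < n % t ] z (t * L + j)) (∑-blocks t L z) ⟩
      ∑[ J < t ] zerosIn i J + ∑[ j < n % t ] z (t * L + j)
        ≤⟨ +-monoʳ-≤ _ (≤-trans (count≤ (n % t) _) (<⇒≤ (m%n<n n t))) ⟩
      ∑[ J < t ] zerosIn i J + t                         ∎
      where
      open ≤-Reasoning
      z : ℕ → ℕ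
      z j = χ (not (a i j))

    zeroCount≤ : zeroCount n a ≤ blockZeros + n * t
    zeroCount≤ = begin
      zeroCount n a                            ≤⟨ ∑-mono-≤ n (λ i _ → rowZeros≤ i) ⟩
      ∑[ i < n ] (∑[ J < t ] zerosIn i J + t)  ≡⟨ ∑-distrib-+ n _ _ ⟩
      blockZeros + ∑[ _ < n ] t                ≡⟨ cong (blockZeros +_) (∑-const n t) ⟩
      blockZeros + n * t                       ∎
      where open ≤-Reasoning

    2m*zerosIn≤ : ∀ i J → 2 * m * zerosIn i J ≤ 2 * m * L * χ (rich i J) + L
    2m*zerosIn≤ i J with L ≤ᵇ 2 * m * zerosIn i J in rich?
    ... | true  = begin
      2 * m * zerosIn i J  ≤⟨ *-monoʳ-≤ (2 * m) (count≤ L _) ⟩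
      2 * m * L            ≡⟨ sym (*-identityʳ (2 * m * L)) ⟩
      2 * m * L * 1        ≤⟨ m≤m+n _ L ⟩
      2 * m * L * 1 + L    ∎
      where open ≤-Reasoning
    ... | false = ≤-trans (<⇒≤ (≰⇒> λ L≤ → subst T rich? (≤⇒≤ᵇ L≤))) (m≤n+m L _)

    2m*blockZeros≤ : 2 * m * blockZeros ≤ 2 * m * L * richPairs + n * (t * L)
    2m*blockZeros≤ = begin
      2 * m * blockZeros
        ≡⟨ sym (trans (∑-cong n (λ i _ → ∑-*ˡ t (2 * m) _)) (∑-*ˡ n (2 * m) _)) ⟩
      ∑[ i < n ] ∑[ J < t ] (2 * m * zerosIn i J)
        ≤⟨ ∑-mono-≤ n (λ i _ → ∑-mono-≤ t (λ J _ → 2m*zerosIn≤ i J)) ⟩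
      ∑[ i < n ] ∑[ J < t ] (2 * m * L * χ (rich i J) + L)
        ≡⟨ trans (∑-cong n (λ i _ → ∑-distrib-+ t _ _)) (∑-distrib-+ n _ _) ⟩
      ∑[ i < n ] ∑[ J < t ] (2 * m * L * χ (rich i J)) + ∑[ _ < n ] ∑[ _ < t ] L
        ≡⟨ cong₂ _+_ (trans (∑-cong n (λ i _ → ∑-*ˡ t (2 * m * L) _)) (∑-*ˡ n (2 * m * L) _))
                     (trans (∑-cong n (λ _ _ → ∑-const t L)) (∑-const n (t * L))) ⟩
      2 * m * L * ∑[ i < n ] ∑[ J < t ] χ (rich i J) + n * (t * L)
        ≡⟨ cong (λ x → 2 * m * L * x + n * (t * L)) (∑-swap n t _) ⟩
      2 * m * L * richPairs + n * (t * L) ∎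
      where open ≤-Reasoning

    n²≤4mL*richPairs : n * n ≤ m * zeroCount n a → 4 * m * t ≤ n → n * n ≤ 4 * m * L * richPairs
    n²≤4mL*richPairs dense 4mt≤n = +-cancelʳ-≤ (3 * (n * n)) _ _ (begin
      n * n + 3 * (n * n)                                      ≡⟨ add-thrice (n * n) ⟩
      4 * (n * n)                                              ≤⟨ *-monoʳ-≤ 4 dense ⟩
      4 * (m * zeroCount n a)                                  ≤⟨ *-monoʳ-≤ 4 (*-monoʳ-≤ m zeroCount≤) ⟩
      4 * (m * (blockZeros + n * t))                           ≡⟨ expand m blockZeros n t ⟩
      2 * (2 * m * blockZeros) + 4 * m * t * n                 ≤⟨ +-mono-≤ (*-monoʳ-≤ 2 2m*blockZeros≤) (*-monoˡ-≤ n 4mt≤n) ⟩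
      2 * (2 * m * L * richPairs + n * (t * L)) + n * n        ≤⟨ +-monoˡ-≤ (n * n) (*-monoʳ-≤ 2
                                                                    (+-monoʳ-≤ (2 * m * L * richPairs) (*-monoʳ-≤ n tL≤n))) ⟩
      2 * (2 * m * L * richPairs + n * n) + n * n              ≡⟨ regroup m L richPairs (n * n) ⟩
      4 * m * L * richPairs + 3 * (n * n)                      ∎)
      where
      open ≤-Reasoning
      add-thrice : ∀ y → y + 3 * y ≡ 4 * y
      add-thrice = solve-∀
      expand : ∀ m z n t → 4 * (m * (z + n * t)) ≡ 2 * (2 * m * z) + 4 * m * t * n
      expand = solve-∀
      regroup : ∀ m L W y → 2 * (2 * m * L * W + y) + y ≡ 4 * m * L * W + 3 * y
      regroup = solve-∀

    4m≤L : 4 * m * t ≤ n → 4 * m ≤ L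
    4m≤L 4mt≤n = subst (_≤ L) (m*n/n≡m (4 * m) t) (/-monoˡ-≤ t 4mt≤n)

    module _ .{{_ : NonZero m}} (4mt≤n : 4 * m * t ≤ n) where

      instance
        L≢0 : NonZero L
        L≢0 = >-nonZero (<-≤-trans (*-monoʳ-< 4 (>-nonZero⁻¹ m)) (4m≤L 4mt≤n))

      n≤2tL : n ≤ 2 * (t * L)
      n≤2tL = begin
        n                  ≡⟨ n≡tL+n%t ⟩
        t * L + n % t      ≤⟨ +-monoʳ-≤ (t * L) (≤-trans (<⇒≤ (m%n<n n t)) (m≤m*n t L)) ⟩
        t * L + t * L      ≡⟨ cong (t * L +_) (sym (+-identityʳ (t * L))) ⟩
        2 * (t * L)        ∎
        where open ≤-Reasoning

      -- Cauchy–Schwarz over the blocks, with richPairs ≥ n² / 4mL and at most 2k crossings per pair of rows.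
      kn²≤2*followerCount : ∀ {k} → P-Free n k a → n * n ≤ m * zeroCount n a → t ≡ 48 * k * m * m →
                            k * (n * n) ≤ followerCount + followerCount
      kn²≤2*followerCount {k} free dense t≡ = *-cancelˡ-≤ Q {{Q≢0}} (+-cancelʳ-≤ (Q * (2 * k * (n * n))) _ _ (begin
        Q * (k * (n * n)) + Q * (2 * k * (n * n))          ≡⟨ expand m L t k n ⟩
        t * (48 * k * m * m) * (L * L) * (n * n)           ≡⟨ cong (λ x → t * x * (L * L) * (n * n)) (sym t≡) ⟩
        t * t * (L * L) * (n * n)                          ≡⟨ regroup t L n ⟩
        (t * L) * (t * L) * (n * n)                        ≤⟨ *-monoˡ-≤ (n * n) (*-mono-≤ tL≤n tL≤n) ⟩
        (n * n) * (n * n)                                  ≤⟨ *-mono-≤ n²≤ n²≤ ⟩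
        (4 * m * L * W) * (4 * m * L * W)                  ≡⟨ square m L W ⟩
        16 * (m * m) * (L * L) * (W * W)                   ≤⟨ *-monoʳ-≤ (16 * (m * m) * (L * L)) (cauchy-schwarz t richRows) ⟩
        16 * (m * m) * (L * L) * (t * S)                   ≡⟨ sym (*-assoc (16 * (m * m) * (L * L)) t S) ⟩
        Q * S                                              ≤⟨ *-monoʳ-≤ Q (≤-trans ∑richRows²≤ (+-monoʳ-≤ (F + F) (crossingCount≤ {k} free))) ⟩
        Q * (F + F + n * (n * (2 * k)))                    ≡⟨ distribute Q F n k ⟩
        Q * (F + F) + Q * (2 * k * (n * n))                ∎))
        where
        open ≤-Reasoning
        W S F Q : ℕ
        W = richPairs
        S = ∑[ J < t ] (richRows J * richRows J)
        F = followerCount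
        Q = 16 * (m * m) * (L * L) * t
        n²≤ : n * n ≤ 4 * m * L * W
        n²≤ = n²≤4mL*richPairs dense 4mt≤n
        Q≢0 : NonZero Q
        Q≢0 = m*n≢0 (16 * (m * m) * (L * L)) t {{m*n≢0 (16 * (m * m)) (L * L) {{m*n≢0 16 (m * m) {{_}} {{m*n≢0 m m}}}} {{m*n≢0 L L}}}}
        expand : ∀ m L t k n → 16 * (m * m) * (L * L) * t * (k * (n * n)) + 16 * (m * m) * (L * L) * t * (2 * k * (n * n))
                               ≡ t * (48 * k * m * m) * (L * L) * (n * n)
        expand = solve-∀
        regroup : ∀ t L n → t * t * (L * L) * (n * n) ≡ (t * L) * (t * L) * (n * n)
        regroup = solve-∀
        square : ∀ m L W → (4 * m * L * W) * (4 * m * L * W) ≡ 16 * (m * m) * (L * L) * (W * W)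
        square = solve-∀
        distribute : ∀ Q F n k → Q * (F + F + n * (n * (2 * k))) ≡ Q * (F + F) + Q * (2 * k * (n * n))
        distribute = solve-∀

      zerosIn-large : ∀ {d e r J} → rich r J ≡ true → 4 * m * t * e ≤ d * n → e ≤ d * zerosIn r J
      zerosIn-large {d} {e} {r} {J} rich-rJ wide-enough = *-cancelˡ-≤ (4 * m * t) {{m*n≢0 (4 * m) t {{m*n≢0 4 m}}}} (begin
        4 * m * t * e                          ≤⟨ wide-enough ⟩
        d * n                                  ≤⟨ *-monoʳ-≤ d n≤2tL ⟩
        d * (2 * (t * L))                      ≤⟨ *-monoʳ-≤ d (*-monoʳ-≤ 2 (*-monoʳ-≤ t (≤ᵇ⇒≤ L _ (subst T (sym rich-rJ) tt)))) ⟩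
        d * (2 * (t * (2 * m * zerosIn r J)))  ≡⟨ regroup d t m (zerosIn r J) ⟩
        4 * m * t * (d * zerosIn r J)          ∎)
        where
        open ≤-Reasoning
        regroup : ∀ d t m z → d * (2 * (t * (2 * m * z))) ≡ 4 * m * t * (d * z)
        regroup = solve-∀

      followerBlock : ∀ {d e} J r → J < t → rich r J ≡ true →
                      e ≤ d * followers J r → 4 * m * t * e ≤ d * n → ZeroBlock n a d e
      followerBlock {d} {e} J r J<t rich-rJ tall wide-enough
        with enumerate n (λ r′ → rich r J ∧ follows r r′ J) | enumerate L (λ s → not (a r (col J s)))
      ... | row , row-spec , row-increasing | s , s-spec , s-increasing = record
        { height = followers J r ; width = zerosIn r J ; row = row ; col = col J ∘ s
        ; row-increasing = (λ x x< → proj₁ (row-spec x x<)) , (λ x y x<y _ → row-increasing x y x<y)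
        ; col-increasing = (λ y y< → blockColumn-bound L t n J (s y) tL≤n J<t (proj₁ (s-spec y y<)))
                         , (λ x y x<y _ → +-monoʳ-< (J * L) (s-increasing x y x<y))
        ; tall = tall
        ; wide = zerosIn-large {d} {e} {r} {J} rich-rJ wide-enough
        ; all-zero = λ x y x< y< → follower-zero {r} {row x} {J} {s y} (proj₂ (∧≡true (proj₂ (row-spec x x<))))
                                                 (proj₁ (s-spec y y<)) (not≡true (proj₂ (s-spec y y<))) }

      followers-rich : ∀ J r → 0 < followers J r → rich r J ≡ true
      followers-rich J r pos with rich r J
      ... | true  = refl
      ... | false = ⊥-elim (<-irrefl (sym (trans (∑-const n 0) (*-zeroʳ n))) pos)

      ∑∑d*followers≥ : ∀ {k d e} → P-Free n k a → n * n ≤ m * zeroCount n a → t ≡ 48 * k * m * m →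
                       2 * t * e ≤ d * (k * n) → t * (n * e) ≤ ∑[ J < t ] ∑[ r < n ] (d * followers J r)
      ∑∑d*followers≥ {k} {d} {e} free dense t≡ tall-enough = *-cancelʳ-≤ _ _ 2 (begin
        t * (n * e) * 2                      ≡⟨ regroup t n e ⟩
        n * (2 * t * e)                      ≤⟨ *-monoʳ-≤ n tall-enough ⟩
        n * (d * (k * n))                    ≡⟨ regroup′ n d k ⟩
        d * (k * (n * n))                    ≤⟨ *-monoʳ-≤ d kn²≤2F ⟩
        d * (followerCount + followerCount)  ≡⟨ double d followerCount ⟩
        d * followerCount * 2                ≡⟨ cong (_* 2) (sym ∑d*followers) ⟩
        ∑[ J < t ] ∑[ r < n ] (d * followers J r) * 2 ∎)
        where
        open ≤-Reasoning
        kn²≤2F : k * (n * n) ≤ followerCount + followerCount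
        kn²≤2F = kn²≤2*followerCount {k} free dense t≡
        ∑d*followers : ∑[ J < t ] ∑[ r < n ] (d * followers J r) ≡ d * followerCount
        ∑d*followers = trans (∑-cong t (λ J _ → ∑-*ˡ n d (followers J))) (∑-*ˡ t d (λ J → ∑[ r < n ] followers J r))
        regroup : ∀ t n e → t * (n * e) * 2 ≡ n * (2 * t * e)
        regroup = solve-∀
        regroup′ : ∀ n d k → n * (d * (k * n)) ≡ d * (k * (n * n))
        regroup′ = solve-∀
        double : ∀ d F → d * (F + F) ≡ d * F * 2
        double = solve-∀

      zeroBlock : ∀ {k d e} → P-Free n k a → n * n ≤ m * zeroCount n a → t ≡ 48 * k * m * m →
                  0 < e → 2 * t * e ≤ d * (k * n) → 4 * m * t * e ≤ d * n → ZeroBlock n a d e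
      zeroBlock {k} {d} {e} free dense t≡ e>0 tall-enough wide-enough =
        let J , J<t , ne≤ = ∃-≥-of-∑-≥ t (n * e) (λ J → ∑[ r < n ] (d * followers J r)) (>-nonZero⁻¹ t)
                              (∑∑d*followers≥ {k} {d} free dense t≡ tall-enough)
            r , _ , e≤ = ∃-≥-of-∑-≥ n e (λ r → d * followers J r) n>0 ne≤
        in followerBlock {d} {e} J r J<t (followers-rich J r (positive e≤)) e≤ wide-enough
        where
        n>0 : 0 < n
        n>0 = <-≤-trans (>-nonZero⁻¹ (4 * m * t) {{m*n≢0 (4 * m) t {{m*n≢0 4 m}}}}) 4mt≤n
        positive : ∀ {f} → e ≤ d * f → 0 < f
        positive {zero}  e≤0 = ⊥-elim (<⇒≱ e>0 (subst (e ≤_) (*-zeroʳ d) e≤0))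
        positive {suc _} _   = z<s

  emptyZeroBlock : ∀ n a d → ZeroBlock n a d 0
  emptyZeroBlock n a d = record
    { height = 0 ; width = 0 ; row = id ; col = id
    ; row-increasing = (λ _ ()) , (λ _ _ _ ())
    ; col-increasing = (λ _ ()) , (λ _ _ _ ())
    ; tall = z≤n ; wide = z≤n ; all-zero = λ _ _ () }

  zeroCount≤n² : ∀ n a → zeroCount n a ≤ n * n
  zeroCount≤n² n a = ∑-≤-* n n (λ i _ → subst (∑[ j < n ] χ (not (a i j)) ≤_) (*-identityʳ n) (∑-≤-* n 1 (λ j _ → χ≤1 (not (a i j)))))

  q<[1+q/p]*p : ∀ p q .{{_ : NonZero p}} → q < suc (q / p) * p
  q<[1+q/p]*p p q = subst (_< suc (q / p) * p) (sym (m≡m%n+[m/n]*n q p)) (+-monoˡ-< ((q / p) * p) (m%n<n q p))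

  [1+q/p]*p≤2q : ∀ p q .{{_ : NonZero p}} → p ≤ q → suc (q / p) * p ≤ 2 * q
  [1+q/p]*p≤2q p q p≤q = ≤-trans (+-mono-≤ p≤q (m/n*n≤m q p)) (≤-reflexive (cong (q +_) (sym (+-identityʳ q))))

  p≤q-of-density : ∀ p q N → 0 < N → p * N ≤ N * q → p ≤ q
  p≤q-of-density p q N N>0 pN≤Nq = *-cancelʳ-≤ p q N {{>-nonZero N>0}} (subst (p * N ≤_) (*-comm N q) pN≤Nq)

  N≤[1+q/p]*Z : ∀ p q N Z .{{_ : NonZero p}} .{{_ : NonZero q}} → p * N ≤ Z * q → N ≤ suc (q / p) * Z
  N≤[1+q/p]*Z p q N Z pN≤Zq = *-cancelʳ-≤ N (m * Z) q (begin
    N * q        ≡⟨ *-comm N q ⟩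
    q * N        ≤⟨ *-monoˡ-≤ N (<⇒≤ (q<[1+q/p]*p p q)) ⟩
    m * p * N    ≡⟨ *-assoc m p N ⟩
    m * (p * N)  ≤⟨ *-monoʳ-≤ m pN≤Zq ⟩
    m * (Z * q)  ≡⟨ *-assoc m Z q ⟨
    m * Z * q    ∎)
    where
    open ≤-Reasoning
    m : ℕ
    m = suc (q / p)

  -- With ε = p / q, m ≈ 1 / ε and t = 48 k m², these say ε⁴ / 10⁴k ≤ 1 / 4mt and ε⁴ / 10⁴k ≤ k / 2t.
  p⁴*4mt≤q⁴*10⁴k : ∀ p q k m → m * p ≤ 2 * q → p ≤ q →
                   p * p * p * p * (4 * m * (48 * k * m * m)) ≤ q * q * q * q * (10000 * k)
  p⁴*4mt≤q⁴*10⁴k p q k m mp≤2q p≤q = begin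
    p * p * p * p * (4 * m * (48 * k * m * m))       ≡⟨ regroup p k m ⟩
    192 * k * ((m * p) * (m * p) * (m * p)) * p      ≤⟨ *-mono-≤ (*-monoʳ-≤ (192 * k) (*-mono-≤ (*-mono-≤ mp≤2q mp≤2q) mp≤2q)) p≤q ⟩
    192 * k * ((2 * q) * (2 * q) * (2 * q)) * q      ≡⟨ regroup′ k q ⟩
    1536 * (k * (q * q * q * q))                     ≤⟨ *-monoˡ-≤ (k * (q * q * q * q)) (≤ᵇ⇒≤ 1536 10000 _) ⟩
    10000 * (k * (q * q * q * q))                    ≡⟨ regroup″ k q ⟩
    q * q * q * q * (10000 * k)                      ∎
    where
    open ≤-Reasoning
    regroup : ∀ p k m → p * p * p * p * (4 * m * (48 * k * m * m)) ≡ 192 * k * ((m * p) * (m * p) * (m * p)) * p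
    regroup = solve-∀
    regroup′ : ∀ k q → 192 * k * ((2 * q) * (2 * q) * (2 * q)) * q ≡ 1536 * (k * (q * q * q * q))
    regroup′ = solve-∀
    regroup″ : ∀ k q → 10000 * (k * (q * q * q * q)) ≡ q * q * q * q * (10000 * k)
    regroup″ = solve-∀

  2t*p⁴≤q⁴*10⁴k*k : ∀ p q k m .{{_ : NonZero k}} → m * p ≤ 2 * q → p ≤ q →
                    2 * (48 * k * m * m) * (p * p * p * p) ≤ q * q * q * q * (10000 * k) * k
  2t*p⁴≤q⁴*10⁴k*k p q k m mp≤2q p≤q = begin
    2 * (48 * k * m * m) * (p * p * p * p)     ≡⟨ regroup p k m ⟩
    96 * k * ((m * p) * (m * p)) * (p * p)     ≤⟨ *-mono-≤ (*-monoʳ-≤ (96 * k) (*-mono-≤ mp≤2q mp≤2q)) (*-mono-≤ p≤q p≤q) ⟩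
    96 * k * ((2 * q) * (2 * q)) * (q * q)     ≡⟨ regroup′ k q ⟩
    384 * (q * q * q * q * k)                  ≤⟨ *-monoˡ-≤ (q * q * q * q * k) (≤ᵇ⇒≤ 384 10000 _) ⟩
    10000 * (q * q * q * q * k)                ≤⟨ *-monoʳ-≤ 10000 (m≤m*n (q * q * q * q * k) k) ⟩
    10000 * (q * q * q * q * k * k)            ≡⟨ regroup″ k q ⟩
    q * q * q * q * (10000 * k) * k            ∎
    where
    open ≤-Reasoning
    regroup : ∀ p k m → 2 * (48 * k * m * m) * (p * p * p * p) ≡ 96 * k * ((m * p) * (m * p)) * (p * p)
    regroup = solve-∀
    regroup′ : ∀ k q → 96 * k * ((2 * q) * (2 * q)) * (q * q) ≡ 384 * (q * q * q * q * k)
    regroup′ = solve-∀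
    regroup″ : ∀ k q → 10000 * (q * q * q * q * k * k) ≡ q * q * q * q * (10000 * k) * k
    regroup″ = solve-∀

  zeroBlock-of-ratio : ∀ p q k m n a .{{_ : NonZero p}} .{{_ : NonZero k}} .{{_ : NonZero m}} .{{_ : NonZero n}} →
                       P-Free n k a → m * p ≤ 2 * q → p ≤ q → n * n ≤ m * zeroCount n a →
                       ZeroBlock n a (q * q * q * q * (10000 * k)) (p * p * p * p * n)
  zeroBlock-of-ratio p q k m n a free mp≤2q p≤q dense = block
    where
    open ≤-Reasoning
    p⁴ d t : ℕ
    p⁴ = p * p * p * p
    d = q * q * q * q * (10000 * k)
    t = 48 * k * m * m
    instance
      t≢0 : NonZero t
      t≢0 = m*n≢0 (48 * k * m) m {{m*n≢0 (48 * k) m {{m*n≢0 48 k}}}}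
      p⁴≢0 : NonZero p⁴
      p⁴≢0 = m*n≢0 (p * p * p) p {{m*n≢0 (p * p) p {{m*n≢0 p p}}}}
    p⁴*4mt≤d : p⁴ * (4 * m * t) ≤ d
    p⁴*4mt≤d = p⁴*4mt≤q⁴*10⁴k p q k m mp≤2q p≤q
    block : ZeroBlock n a d (p⁴ * n)
    block with 4 * m * t ≤? n
    ... | yes 4mt≤n = Blocks.zeroBlock a n m t 4mt≤n {k} {d} free dense refl (>-nonZero⁻¹ (p⁴ * n) {{m*n≢0 p⁴ n}}) tall wide
      where
      tall : 2 * t * (p⁴ * n) ≤ d * (k * n)
      tall = begin
        2 * t * (p⁴ * n)  ≡⟨ *-assoc (2 * t) p⁴ n ⟨
        2 * t * p⁴ * n    ≤⟨ *-monoˡ-≤ n (2t*p⁴≤q⁴*10⁴k*k p q k m mp≤2q p≤q) ⟩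
        d * k * n         ≡⟨ *-assoc d k n ⟩
        d * (k * n)       ∎
      wide : 4 * m * t * (p⁴ * n) ≤ d * n
      wide = begin
        4 * m * t * (p⁴ * n)  ≡⟨ *-assoc (4 * m * t) p⁴ n ⟨
        4 * m * t * p⁴ * n    ≡⟨ cong (_* n) (*-comm (4 * m * t) p⁴) ⟩
        p⁴ * (4 * m * t) * n  ≤⟨ *-monoˡ-≤ n p⁴*4mt≤d ⟩
        d * n                 ∎
    ... | no 4mt≰n = singletonZeroBlock n a d (p⁴ * n) zeros>0 (≤-trans (*-monoʳ-≤ p⁴ (<⇒≤ (≰⇒> 4mt≰n))) p⁴*4mt≤d)
      where
      zeros>0 : 0 < zeroCount n a
      zeros>0 = n≢0⇒n>0 λ none → <⇒≱ (>-nonZero⁻¹ (n * n) {{m*n≢0 n n}})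
                                      (subst (n * n ≤_) (trans (cong (m *_) none) (*-zeroʳ m)) dense)

  zeroBlock-of-density : ∀ p q k n a .{{_ : NonZero p}} .{{_ : NonZero k}} → P-Free n k a →
                         p * (n * n) ≤ zeroCount n a * q →
                         ZeroBlock n a (q * q * q * q * (10000 * k)) (p * p * p * p * n)
  zeroBlock-of-density p q k zero a _ _ = subst (ZeroBlock 0 a _) (sym (*-zeroʳ (p * p * p * p))) (emptyZeroBlock 0 a _)
  zeroBlock-of-density p q k n@(suc _) a free dense =
    zeroBlock-of-ratio p q k (suc (q / p)) n a free ([1+q/p]*p≤2q p q p≤q) p≤q (N≤[1+q/p]*Z p q (n * n) (zeroCount n a) dense)
    where
    p≤q : p ≤ q
    p≤q = p≤q-of-density p q (n * n) z<s (≤-trans dense (*-monoˡ-≤ q (zeroCount≤n² n a)))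
    instance
      q≢0 : NonZero q
      q≢0 = >-nonZero (<-≤-trans (>-nonZero⁻¹ p) p≤q)

module Fractions where

  open import Data.Nat as ℕ using (ℕ; suc)
  open import Data.Nat.Properties using (*-identityʳ; *-comm)
  open import Data.Integer as ℤ using (+_)
  open import Data.Integer.Properties using (pos-*; drop‿+≤+)
  open import Data.Rational as ℚ using (ℚ; toℚᵘ; _/_)
  open import Data.Rational.Properties using (toℚᵘ-homo-*; toℚᵘ-fromℚᵘ; toℚᵘ-mono-≤; toℚᵘ-cancel-≤)
  open import Data.Rational.Unnormalised as ℚᵘ using (mkℚᵘ; *≡*; *≤*)
  open import Data.Rational.Unnormalised.Properties as ℚᵘ using (≃-trans; ≃-sym)
  open import Relation.Binary.PropositionalEquality

  -- x = a / b for b ≠ 0. Denominators are always given as successors, so that the pred below and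
  -- the one in a product pred (suc b * suc d) reduce away.
  record Represents (x : ℚ) (a b : ℕ) : Set where
    constructor represents
    field toℚᵘ-≃ : toℚᵘ x ℚᵘ.≃ mkℚᵘ (+ a) (ℕ.pred b)

  represents-toℚ : ∀ n → Represents (toℚ n) n 1
  represents-toℚ n = represents (toℚᵘ-fromℚᵘ (mkℚᵘ (+ n) 0))

  represents-1/ : ∀ k → Represents (+ 1 / suc k) 1 (suc k)
  represents-1/ k = represents (toℚᵘ-fromℚᵘ (mkℚᵘ (+ 1) k))

  represents-* : ∀ {x y a b c d} → Represents x a (suc b) → Represents y c (suc d) →
                 Represents (x ℚ.* y) (a ℕ.* c) (suc b ℕ.* suc d)
  represents-* {x} {y} {a} {b} {c} {d} (represents x≐) (represents y≐) = represents (
    ≃-trans (toℚᵘ-homo-* x y) (≃-trans (ℚᵘ.*-cong x≐ y≐) (*≡* (cong (ℤ._* + (suc b ℕ.* suc d)) (sym (pos-* a c))))))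

  represents-ℚ≤⇒ℕ≤ : ∀ {x y a b c d} → Represents x a (suc b) → Represents y c (suc d) →
                  x ℚ.≤ y → a ℕ.* suc d ℕ.≤ c ℕ.* suc b
  represents-ℚ≤⇒ℕ≤ {a = a} {b} {c} {d} (represents x≐) (represents y≐) x≤y with ℚᵘ.≤-respʳ-≃ y≐ (ℚᵘ.≤-respˡ-≃ x≐ (toℚᵘ-mono-≤ x≤y))
  ... | *≤* le = drop‿+≤+ (subst₂ ℤ._≤_ (sym (pos-* a (suc d))) (sym (pos-* c (suc b))) le)

  represents-ℕ≤⇒ℚ≤ : ∀ {x y a b c d} → Represents x a (suc b) → Represents y c (suc d) →
                 a ℕ.* suc d ℕ.≤ c ℕ.* suc b → x ℚ.≤ y
  represents-ℕ≤⇒ℚ≤ {a = a} {b} {c} {d} (represents x≐) (represents y≐) le =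
    toℚᵘ-cancel-≤ (ℚᵘ.≤-respʳ-≃ (≃-sym y≐) (ℚᵘ.≤-respˡ-≃ (≃-sym x≐)
      (*≤* (subst₂ ℤ._≤_ (pos-* a (suc d)) (pos-* c (suc b)) (ℤ.+≤+ le)))))

  *-toℚ-≤⇒ : ∀ {x a b} N Z → Represents x a (suc b) → x ℚ.* toℚ N ℚ.≤ toℚ Z → a ℕ.* N ℕ.≤ Z ℕ.* suc b
  *-toℚ-≤⇒ {b = b} N Z x≐ le = subst₂ ℕ._≤_ (*-identityʳ _) (cong (Z ℕ.*_) (*-identityʳ (suc b)))
    (represents-ℚ≤⇒ℕ≤ (represents-* x≐ (represents-toℚ N)) (represents-toℚ Z) le)

  ⇒*-toℚ-≤ : ∀ {x a b} N Z → Represents x a (suc b) → a ℕ.* N ℕ.≤ suc b ℕ.* Z → x ℚ.* toℚ N ℚ.≤ toℚ Z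
  ⇒*-toℚ-≤ {b = b} N Z x≐ le = represents-ℕ≤⇒ℚ≤ (represents-* x≐ (represents-toℚ N)) (represents-toℚ Z)
    (subst₂ ℕ._≤_ (sym (*-identityʳ _)) (trans (*-comm (suc b) Z) (cong (Z ℕ.*_) (sym (*-identityʳ (suc b))))) le)

module FromMatrices where

  open import Data.Nat as ℕ using (ℕ; zero; suc; _<?_)
  open import Data.Nat.Properties using (<-trans)
  open import Data.Fin as Fin using (Fin; toℕ; fromℕ<)
  open import Data.Fin.Properties using (toℕ<n; fromℕ<-toℕ; toℕ-fromℕ<)
  open import Data.Bool using (true; false; not; if_then_else_)
  open import Data.Product using (Σ; _×_; _,_; proj₁; proj₂)
  open import Function using (_∘_)
  open import Relation.Nullary using (yes; no; contradiction)
  open import Relation.Binary.PropositionalEquality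
  import Data.Rational as ℚ
  open FiniteSums
  open Grids

  finIncreasing : ∀ {len n f} → Increasing len n f →
    Σ (Fin len → Fin n) λ g → StrictlyIncreasing g × (∀ x → toℕ (g x) ≡ f (toℕ x))
  finIncreasing {len} {n} {f} (bound , increasing) =
    g , (λ x y x<y → subst₂ ℕ._<_ (sym (g-toℕ x)) (sym (g-toℕ y)) (increasing _ _ x<y (toℕ<n y))) , g-toℕ
    where
    g : Fin len → Fin n
    g x = fromℕ< (bound (toℕ x) (toℕ<n x))
    g-toℕ : ∀ x → toℕ (g x) ≡ f (toℕ x)
    g-toℕ x = toℕ-fromℕ< (bound (toℕ x) (toℕ<n x))

  pair : ℕ → ℕ → ℕ → ℕ
  pair i₁ i₂ zero    = i₁
  pair i₁ i₂ (suc _) = i₂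

  pair-increasing : ∀ {i₁ i₂ n} → i₁ ℕ.< i₂ → i₂ ℕ.< n → Increasing 2 n (pair i₁ i₂)
  pair-increasing {i₁} {i₂} {n} i₁<i₂ i₂<n = bound , increasing
    where
    bound : ∀ x → x ℕ.< 2 → pair i₁ i₂ x ℕ.< n
    bound zero    _ = <-trans i₁<i₂ i₂<n
    bound (suc _) _ = i₂<n
    increasing : ∀ x y → x ℕ.< y → y ℕ.< 2 → pair i₁ i₂ x ℕ.< pair i₁ i₂ y
    increasing zero    (suc zero)    _           _                     = i₁<i₂
    increasing (suc _) (suc zero)    (ℕ.s≤s ()) _
    increasing _       (suc (suc _)) _           (ℕ.s≤s (ℕ.s≤s ()))

  module _ {n : ℕ} (A : Matrix n n) where

    -- Entries outside the n × n square are junk; they are set to 1 so they never count as zeros.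
    toGrid : Grid
    toGrid i j with i <? n | j <? n
    ... | yes i<n | yes j<n = A (fromℕ< i<n) (fromℕ< j<n)
    ... | _       | _       = true

    toGrid-fromℕ< : ∀ {i j} (i<n : i ℕ.< n) (j<n : j ℕ.< n) → toGrid i j ≡ A (fromℕ< i<n) (fromℕ< j<n)
    toGrid-fromℕ< {i} {j} i<n j<n with i <? n | j <? n
    ... | yes _   | yes _   = refl
    ... | no i≮n  | _       = contradiction i<n i≮n
    ... | yes _   | no j≮n  = contradiction j<n j≮n

    toGrid-toℕ : ∀ x y → toGrid (toℕ x) (toℕ y) ≡ A x y
    toGrid-toℕ x y = trans (toGrid-fromℕ< (toℕ<n x) (toℕ<n y)) (cong₂ A (fromℕ<-toℕ x _) (fromℕ<-toℕ y _))

    toGrid-entry : ∀ {x y i j} → toℕ x ≡ i → toℕ y ≡ j → A x y ≡ toGrid i j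
    toGrid-entry {x} {y} refl refl = sym (toGrid-toℕ x y)

    zeros≡zeroCount : zeros A ≡ zeroCount n toGrid
    zeros≡zeroCount = sumFin≡∑ n _ _ (λ x → sumFin≡∑ n _ _ (λ y →
                        trans (if-χ-not (A x y)) (cong (χ ∘ not) (sym (toGrid-toℕ x y)))))
      where
      sumFin≡∑ : ∀ m (f : Fin m → ℕ) (g : ℕ → ℕ) → (∀ x → f x ≡ g (toℕ x)) → sumFin m f ≡ ∑ m g
      sumFin≡∑ zero    f g eq = refl
      sumFin≡∑ (suc m) f g eq = cong₂ ℕ._+_ (eq Fin.zero) (sumFin≡∑ m (f ∘ Fin.suc) (g ∘ suc) (eq ∘ Fin.suc))
      if-χ-not : ∀ b → (if b then 0 else 1) ≡ χ (not b)
      if-χ-not true  = refl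
      if-χ-not false = refl

    P-Free-toGrid : ∀ k → Free A (P (2 ℕ.* k)) → P-Free n k toGrid
    P-Free-toGrid k free i₁ i₂ c i₁<i₂ i₂<n c-increasing alternates =
      let r , r-inc , r-toℕ = finIncreasing (pair-increasing i₁<i₂ i₂<n)
          c′ , c′-inc , c′-toℕ = finIncreasing c-increasing
          entries : ∀ a b → A (r a) (c′ b) ≡ P (2 ℕ.* k) a b
          entries = λ where
            Fin.zero           b → trans (toGrid-entry (r-toℕ Fin.zero) (c′-toℕ b)) (proj₁ (alternates (toℕ b) (toℕ<n b)))
            (Fin.suc Fin.zero) b → trans (toGrid-entry (r-toℕ (Fin.suc Fin.zero)) (c′-toℕ b)) (proj₂ (alternates (toℕ b) (toℕ<n b)))
      in free (r , c′ , r-inc , c′-inc , entries)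

    hasZeroBlock : ∀ δ d e → ZeroBlock n toGrid d e → (∀ x → e ℕ.≤ d ℕ.* x → δ ℚ.* toℚ n ℚ.≤ toℚ x) →
                   HasZeroBlock A δ
    hasZeroBlock δ d e block large with finIncreasing (ZeroBlock.row-increasing block) | finIncreasing (ZeroBlock.col-increasing block)
    ... | r , r-inc , r-toℕ | c , c-inc , c-toℕ =
      height , width , r , c , r-inc , c-inc , large height tall , large width wide ,
      λ x y → trans (toGrid-entry (r-toℕ x) (c-toℕ y)) (all-zero (toℕ x) (toℕ y) (toℕ<n x) (toℕ<n y))
      where
      open ZeroBlock block

open import Data.Nat using (ℕ; NonZero; _*_)
open import Data.Integer using (+_)
open import Data.Rational using (ℚ; _/_; _<_; 0ℚ) renaming (_*_ to _*ℚ_)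

open import Data.Nat using (suc; _≤_)
open import Data.Integer as ℤ using (-[1+_])
open import Data.Rational as ℚ using (mkℚ)
open import Data.Rational.Unnormalised.Properties using (≃-refl)
open import Data.Nat.Properties using (*-identityʳ)
open import Relation.Binary.PropositionalEquality using (subst)
open Grids using (zeroCount; ZeroBlock; zeroBlock-of-density)
open FromMatrices
open Fractions

lemma4p2 : (k : ℕ) → .{{_ : NonZero k}} → (ε : ℚ) → 0ℚ < ε →
    Good (P (2 * k)) ε ((ε *ℚ ε *ℚ ε *ℚ ε) *ℚ ((+ 1 / 10000) *ℚ (+ 1 / k)))
lemma4p2 (suc k) (mkℚ (+ 0) _ _)    (ℚ.*<* (ℤ.+<+ ()))
lemma4p2 (suc k) (mkℚ -[1+ _ ] _ _) (ℚ.*<* ())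
lemma4p2 (suc k) ε@(mkℚ (+ suc p) d _) _ n A free dense =
  hasZeroBlock A δ D (p⁴ * n) block (λ x → ⇒*-toℚ-≤ n x δ≐)
  where
  p⁴ D : ℕ
  p⁴ = suc p * suc p * suc p * suc p
  D = suc d * suc d * suc d * suc d * (10000 * suc k)
  δ : ℚ
  δ = (ε *ℚ ε *ℚ ε *ℚ ε) *ℚ ((+ 1 / 10000) *ℚ (+ 1 / suc k))
  ε≐ : Represents ε (suc p) (suc d)
  ε≐ = represents ≃-refl
  δ≐ : Represents δ p⁴ D
  δ≐ = subst (λ a → Represents δ a D) (*-identityʳ p⁴)
         (represents-* (represents-* (represents-* (represents-* ε≐ ε≐) ε≐) ε≐)
                       (represents-* (represents-1/ 9999) (represents-1/ k)))
  dense′ : suc p * (n * n) ≤ zeroCount n (toGrid A) * suc d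
  dense′ = subst (λ Z → suc p * (n * n) ≤ Z * suc d) (zeros≡zeroCount A) (*-toℚ-≤⇒ (n * n) (zeros A) ε≐ dense)
  block : ZeroBlock n (toGrid A) D (p⁴ * n)
  block = zeroBlock-of-density (suc p) (suc d) (suc k) n (toGrid A) (P-Free-toGrid A (suc k) free) dense′
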